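{- For $i=1,2$ let $U_i$ be a $(1,k_i)_q$-evasive subspace of $V_i=V(r_i,q^n)$. Then $U=U_1\oplus U_2$ is a $(1,\max\{k_1,k_2\})_q$-evasive subspace of $V=V_1\oplus V_2$.
   Context: $V(m,q^n)$ denotes an $m$-dimensional vector space over $\mathbb{F}_{q^n}$, viewed also as an $mn$-dimensional vector space over $\mathbb{F}_q$. For positive integers $h,k$, an $\mathbb{F}_q$-subspace $U$ of an $\mathbb{F}_{q^n}$-vector space $V$ is called $(h,k)_q$-evasive if $\langle U\rangle_{\mathbb{F}_{q^n}}$ has $\mathbb{F}_{q^n}$-dimension at least $h$ and every $h$-dimensional $\mathbb{F}_{q^n}$-subspace of $V$ meets $U$ in an $\mathbb{F}_q$-subspace of $\mathbb{F}_q$-dimension at most $k$. -}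

module Defs where

open import Level using (Level; _⊔_)
open import Algebra.Bundles using (CommutativeRing)
open import Data.Nat using (ℕ; zero; suc)
open import Data.Fin using (Fin; zero; suc; _↑ˡ_; _↑ʳ_)
open import Data.Product using (Σ; ∃; _×_; _,_)
open import Relation.Unary using (Pred)
open import Relation.Nullary using (¬_)
open import Relation.Binary.PropositionalEquality using (_≡_)

-- Linear algebra over a commutative ring R (to be assumed a field) with a
-- distinguished sub-"field" K (a predicate on the carrier of R).
-- Throughout: L = F_{q^n} is R, F_q is K, V(r,q^n) is Fin r → Carrier.
module Lin {c ℓ k : Level} (R : CommutativeRing c ℓ) (K : Pred (CommutativeRing.Carrier R) k) where
  open CommutativeRing R using (Carrier; _≈_; _+_; _*_; -_; 0#; 1#)

  IsFieldRing : Set (c ⊔ ℓ)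
  IsFieldRing = (¬ (0# ≈ 1#)) × (∀ x → ¬ (x ≈ 0#) → Σ Carrier λ y → (x * y) ≈ 1#)

  record IsSubfield : Set (c ⊔ ℓ ⊔ k) where
    field
      resp  : ∀ {x y} → x ≈ y → K x → K y
      has0  : K 0#
      has1  : K 1#
      +-cl  : ∀ {x y} → K x → K y → K (x + y)
      neg-cl : ∀ {x} → K x → K (- x)
      *-cl  : ∀ {x y} → K x → K y → K (x * y)
      inv-cl : ∀ {x y} → K x → (x * y) ≈ 1# → K y

  sumR : ∀ {m} → (Fin m → Carrier) → Carrier
  sumR {zero} f = 0#
  sumR {suc m} f = f zero + sumR (λ i → f (suc i))

  Vec : ℕ → Set c
  Vec r = Fin r → Carrier

  _≈ᵥ_ : ∀ {r} → Vec r → Vec r → Set ℓ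
  u ≈ᵥ v = ∀ i → u i ≈ v i

  0ᵥ : ∀ {r} → Vec r
  0ᵥ i = 0#

  _+ᵥ_ : ∀ {r} → Vec r → Vec r → Vec r
  (u +ᵥ v) i = u i + v i

  _·_ : ∀ {r} → Carrier → Vec r → Vec r
  (a · v) i = a * v i

  lincomb : ∀ {m r} → (Fin m → Carrier) → (Fin m → Vec r) → Vec r
  lincomb cs w j = sumR (λ i → cs i * w i j)

  record IsKSubspace {a : Level} {r : ℕ} (U : Pred (Vec r) a) : Set (c ⊔ ℓ ⊔ k ⊔ a) where
    field
      resp  : ∀ {u v} → u ≈ᵥ v → U u → U v
      has0  : U 0ᵥ
      +-cl  : ∀ {u v} → U u → U v → U (u +ᵥ v)
      ·-cl  : ∀ {a v} → K a → U v → U (a · v)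

  KIndep : ∀ {m r} → (Fin m → Vec r) → Set (c ⊔ ℓ ⊔ k)
  KIndep w = ∀ cs → (∀ i → K (cs i)) → lincomb cs w ≈ᵥ 0ᵥ → ∀ i → cs i ≈ 0#

  LIndep : ∀ {m r} → (Fin m → Vec r) → Set (c ⊔ ℓ)
  LIndep w = ∀ cs → lincomb cs w ≈ᵥ 0ᵥ → ∀ i → cs i ≈ 0#

  KDim≤ : ∀ {a r} → Pred (Vec r) a → ℕ → Set (c ⊔ ℓ ⊔ k ⊔ a)
  KDim≤ S d = ∀ (w : Fin (suc d) → Vec _) → (∀ i → S (w i)) → ¬ KIndep w

  LSpanFam : ∀ {m r} → (Fin m → Vec r) → Pred (Vec r) (c ⊔ ℓ)
  LSpanFam w v = Σ (Fin _ → Carrier) λ cs → v ≈ᵥ lincomb cs w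

  LSpan : ∀ {a r} → Pred (Vec r) a → Pred (Vec r) (c ⊔ ℓ ⊔ a)
  LSpan U v = Σ ℕ λ m → Σ (Fin m → Vec _) λ w → (∀ i → U (w i)) × LSpanFam w v

  LDimSpan≥ : ∀ {a r} → Pred (Vec r) a → ℕ → Set (c ⊔ ℓ ⊔ a)
  LDimSpan≥ U h = Σ (Fin h → Vec _) λ w → (∀ i → LSpan U (w i)) × LIndep w

  -- (h,d)_q-evasive: every h-dimensional L-subspace W = ⟨b_1..b_h⟩_L (b independent)
  -- meets U in a K-subspace of K-dimension ≤ d
  Evasive : ∀ {a r} → Pred (Vec r) a → ℕ → ℕ → Set (c ⊔ ℓ ⊔ k ⊔ a)
  Evasive {r = r} U h d =
    LDimSpan≥ U h ×
    (∀ (b : Fin h → Vec r) → LIndep b → KDim≤ (λ v → LSpanFam b v × U v) d)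

  -- external direct sum U1 ⊕ U2 inside V(r1,q^n) ⊕ V(r2,q^n) = V(r1+r2,q^n)
  _⊕_ : ∀ {a r₁ r₂} → Pred (Vec r₁) a → Pred (Vec r₂) a → Pred (Vec (r₁ Data.Nat.+ r₂)) a
  _⊕_ {r₁ = r₁} {r₂} U₁ U₂ v = U₁ (λ i → v (i ↑ˡ r₂)) × U₂ (λ j → v (r₁ ↑ʳ j))

  HasSize : ℕ → Set (c ⊔ ℓ ⊔ k)
  HasSize q = Σ (Fin q → Carrier) λ e →
    (∀ i → K (e i)) × (∀ {x} → K x → Σ (Fin q) λ i → x ≈ e i) × (∀ i j → e i ≈ e j → i ≡ j)

  HasDegree : ℕ → Set (c ⊔ ℓ ⊔ k)
  HasDegree n = Σ (Fin n → Carrier) λ b →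
    (∀ (cs : Fin n → Carrier) → (∀ i → K (cs i)) → sumR (λ i → cs i * b i) ≈ 0# → ∀ i → cs i ≈ 0#) ×
    (∀ x → Σ (Fin n → Carrier) λ cs → (∀ i → K (cs i)) × x ≈ sumR (λ i → cs i * b i))

module Submission where

-- Being a K-subspace and spanning a nonzero L-space pass to U₁ ⊕ U₂ blockwise.
-- The content is the bound on  ⟨b⟩_L ∩ (U₁ ⊕ U₂)  for a nonzero vector b.  Since
-- K is finite and [L : K] is finite, equality with 0 in L is decidable, so b
-- has a coordinate x₀ with b x₀ invertible; x₀ lies in the first or the second
-- block, say the block of Uᵢ.  Restricting to that block sends the line ⟨b⟩ to
-- the line ⟨b restricted⟩ (still nonzero, by the same coordinate) and
-- U₁ ⊕ U₂ into Uᵢ.  On the line ⟨b⟩ this restriction preserves K-independence: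
-- a vector of ⟨b⟩ vanishing at x₀ is zero.  So K-independent vectors of
-- ⟨b⟩ ∩ (U₁ ⊕ U₂) restrict to K-independent vectors of a 1-dimensional
-- intersection with Uᵢ, whence there are at most kᵢ ≤ k₁ ⊔ k₂ of them.

open import Defs
open import Level using (Level)
open import Algebra.Bundles using (CommutativeRing)
import Data.Nat as ℕ
open import Data.Nat using (ℕ; _⊔_; suc; _≤′_; ≤′-reflexive; ≤′-step)
open import Data.Nat.Properties using (m≤m⊔n; m≤n⊔m; ≤⇒≤′)
open import Data.Product using (_×_; _,_; proj₁; proj₂; Σ; ∃)
open import Data.Sum using (inj₁; inj₂; [_,_]; _⊎_)
open import Data.Fin using (Fin; zero; suc; _↑ˡ_; _↑ʳ_; splitAt; _≟_)
open import Data.Fin.Properties using (splitAt-↑ˡ; splitAt-↑ʳ; splitAt⁻¹-↑ˡ; splitAt⁻¹-↑ʳ; all?; ¬∀⟶∃¬)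
open import Function using (_∘_)
open import Relation.Unary using (Pred)
open import Relation.Nullary using (¬_; Dec; yes; no)
open import Relation.Binary.PropositionalEquality as P using (_≡_)

block-of : ∀ m {n} (x : Fin (m ℕ.+ n)) → (∃ λ i → i ↑ˡ n ≡ x) ⊎ (∃ λ j → m ↑ʳ j ≡ x)
block-of m x with splitAt m x in eq
... | inj₁ i = inj₁ (i , splitAt⁻¹-↑ˡ eq)
... | inj₂ j = inj₂ (j , splitAt⁻¹-↑ʳ eq)

module DirectSum {c ℓ k : Level} (R : CommutativeRing c ℓ) (K : Pred (CommutativeRing.Carrier R) k) where
  open CommutativeRing R hiding (zero)
  open Lin R K

  sumR-cong : ∀ {m} {f g : Fin m → Carrier} → (∀ i → f i ≈ g i) → sumR f ≈ sumR g
  sumR-cong {ℕ.zero} _ = refl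
  sumR-cong {suc m} f≈g = +-cong (f≈g zero) (sumR-cong (f≈g ∘ suc))

  sumR-zeros : ∀ {m} {f : Fin m → Carrier} → (∀ i → f i ≈ 0#) → sumR f ≈ 0#
  sumR-zeros {ℕ.zero} _ = refl
  sumR-zeros {suc m} f≈0 = trans (+-cong (f≈0 zero) (sumR-zeros (f≈0 ∘ suc))) (+-identityʳ 0#)

  sumR-*ʳ : ∀ {m} (f : Fin m → Carrier) y → sumR (λ i → f i * y) ≈ sumR f * y
  sumR-*ʳ {ℕ.zero} f y = sym (zeroˡ y)
  sumR-*ʳ {suc m} f y = trans (+-cong refl (sumR-*ʳ (f ∘ suc) y)) (sym (distribʳ y (f zero) _))

  unit-cancel : ∀ {s β β⁻¹} → s * β ≈ 0# → β * β⁻¹ ≈ 1# → s ≈ 0#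
  unit-cancel {s} {β} {β⁻¹} sβ≈0 ββ⁻¹≈1 = begin
    s               ≈⟨ sym (*-identityʳ s) ⟩
    s * 1#          ≈⟨ *-cong refl (sym ββ⁻¹≈1) ⟩
    s * (β * β⁻¹)   ≈⟨ sym (*-assoc s β β⁻¹) ⟩
    (s * β) * β⁻¹   ≈⟨ *-cong sβ≈0 refl ⟩
    0# * β⁻¹        ≈⟨ zeroˡ β⁻¹ ⟩
    0#              ∎
    where open import Relation.Binary.Reasoning.Setoid setoid

  LineMeet : ∀ {a N} → (Fin 1 → Vec N) → Pred (Vec N) a → Pred (Vec N) (c Level.⊔ ℓ Level.⊔ a)
  LineMeet b U v = LSpanFam b v × U v

  on-line : ∀ {N} {b : Fin 1 → Vec N} {v} (v∈⟨b⟩ : LSpanFam b v) → ∀ x → v x ≈ proj₁ v∈⟨b⟩ zero * b zero x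
  on-line (cs , v≈) x = trans (v≈ x) (+-identityʳ _)

  lincomb-on-line : ∀ {m N} (cs : Fin m → Carrier) (w : Fin m → Vec N) (cc : Fin m → Carrier) (u : Vec N)
    → (∀ l x → w l x ≈ cc l * u x) → ∀ x → lincomb cs w x ≈ sumR (λ l → cs l * cc l) * u x
  lincomb-on-line cs w cc u w≈ x =
    trans (sumR-cong (λ l → trans (*-cong refl (w≈ l x)) (sym (*-assoc (cs l) (cc l) (u x)))))
          (sumR-*ʳ (λ l → cs l * cc l) (u x))

  vanish-on-line : ∀ {N} {v u : Vec N} {s β⁻¹} x₀ → (∀ x → v x ≈ s * u x)
    → v x₀ ≈ 0# → u x₀ * β⁻¹ ≈ 1# → ∀ x → v x ≈ 0#
  vanish-on-line x₀ v≈su vx₀≈0 inv x =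
    trans (v≈su x) (trans (*-cong (unit-cancel (trans (sym (v≈su x₀)) vx₀≈0) inv) refl) (zeroˡ _))

  unit-coordinate⇒LIndep : ∀ {N} (b : Fin 1 → Vec N) x₀ {β⁻¹} → b zero x₀ * β⁻¹ ≈ 1# → LIndep b
  unit-coordinate⇒LIndep b x₀ inv cs comb≈0 zero = unit-cancel (trans (sym (+-identityʳ _)) (comb≈0 x₀)) inv

  LIndep⇒unit-coordinate : IsFieldRing → (∀ x → Dec (x ≈ 0#)) → ∀ {N} (b : Fin 1 → Vec N)
    → LIndep b → Σ (Fin N) λ x₀ → Σ Carrier λ β⁻¹ → b zero x₀ * β⁻¹ ≈ 1#
  LIndep⇒unit-coordinate (0≉1 , inverse) zero? b b-indep
    with ¬∀⟶∃¬ _ (λ x → b zero x ≈ 0#) (zero? ∘ b zero) b≉0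
    where
    b≉0 : ¬ (∀ x → b zero x ≈ 0#)
    b≉0 b≈0 = 0≉1 (sym (b-indep (λ _ → 1#) (λ x → trans (+-identityʳ _) (trans (*-identityˡ _) (b≈0 x))) zero))
  ... | x₀ , bx₀≉0 = x₀ , inverse _ bx₀≉0

  ⊕-isKSubspace : ∀ {a r₁ r₂} {U₁ : Pred (Vec r₁) a} {U₂ : Pred (Vec r₂) a}
    → IsKSubspace U₁ → IsKSubspace U₂ → IsKSubspace (U₁ ⊕ U₂)
  ⊕-isKSubspace {r₁ = r₁} {r₂} s₁ s₂ = record
    { resp = λ eq (u₁ , u₂) → S₁.resp (eq ∘ (_↑ˡ r₂)) u₁ , S₂.resp (eq ∘ (r₁ ↑ʳ_)) u₂
    ; has0 = S₁.has0 , S₂.has0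
    ; +-cl = λ (u₁ , u₂) (v₁ , v₂) → S₁.+-cl u₁ v₁ , S₂.+-cl u₂ v₂
    ; ·-cl = λ Ka (u₁ , u₂) → S₁.·-cl Ka u₁ , S₂.·-cl Ka u₂ }
    where
    module S₁ = IsKSubspace s₁
    module S₂ = IsKSubspace s₂

  inl : ∀ {r₁ r₂} → Vec r₁ → Vec (r₁ ℕ.+ r₂)
  inl {r₁} v x = [ v , (λ _ → 0#) ] (splitAt r₁ x)

  inl-↑ˡ : ∀ {r₁ r₂} (v : Vec r₁) i → inl {r₁} {r₂} v (i ↑ˡ r₂) ≡ v i
  inl-↑ˡ {r₁} {r₂} v i rewrite splitAt-↑ˡ r₁ i r₂ = P.refl

  inl-↑ʳ : ∀ {r₁ r₂} (v : Vec r₁) j → inl {r₁} {r₂} v (r₁ ↑ʳ j) ≡ 0#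
  inl-↑ʳ {r₁} {r₂} v j rewrite splitAt-↑ʳ r₁ r₂ j = P.refl

  ⊕-LDimSpan≥ : ∀ {a r₁ r₂ h} {U₁ : Pred (Vec r₁) a} {U₂ : Pred (Vec r₂) a}
    → IsKSubspace U₁ → IsKSubspace U₂ → LDimSpan≥ U₁ h → LDimSpan≥ (U₁ ⊕ U₂) h
  ⊕-LDimSpan≥ {r₁ = r₁} {r₂} {U₁ = U₁} {U₂} s₁ s₂ (w , w∈⟨U₁⟩ , w-indep) =
    inl ∘ w , inl-LSpan ∘ w∈⟨U₁⟩ , inl-w-indep
    where
    inl-∈ : ∀ {u} → U₁ u → (U₁ ⊕ U₂) (inl u)
    inl-∈ {u} u∈ = IsKSubspace.resp s₁ (λ i → reflexive (P.sym (inl-↑ˡ u i))) u∈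
                 , IsKSubspace.resp s₂ (λ j → reflexive (P.sym (inl-↑ʳ u j))) (IsKSubspace.has0 s₂)
    inl-LSpan : ∀ {v} → LSpan U₁ v → LSpan (U₁ ⊕ U₂) (inl v)
    inl-LSpan {v} (m , u , u∈ , cs , v≈) = m , inl ∘ u , inl-∈ ∘ u∈ , cs , λ x → blockwise (splitAt r₁ x)
      where
      blockwise : (s : Fin r₁ ⊎ Fin r₂) → [ v , (λ _ → 0#) ] s ≈ sumR (λ t → cs t * [ u t , (λ _ → 0#) ] s)
      blockwise (inj₁ i) = v≈ i
      blockwise (inj₂ j) = sym (sumR-zeros (λ t → zeroʳ (cs t)))
    -- on the first block, a relation among the inl w is a relation among the w
    inl-w-indep : LIndep (inl ∘ w)
    inl-w-indep cs comb≈0 = w-indep cs λ i →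
      trans (sumR-cong (λ t → *-cong refl (reflexive (P.sym (inl-↑ˡ {r₂ = r₂} (w t) i))))) (comb≈0 (i ↑ˡ r₂))

  module Finite (sub : IsSubfield) {q n : ℕ} (size : HasSize q) (degree : HasDegree n) where
    open IsSubfield sub using (has0)

    -- In K: compare the enumeration indices of y and of 0.
    zero?-K : ∀ {y} → K y → Dec (y ≈ 0#)
    zero?-K {y} Ky with proj₁ (proj₂ (proj₂ size)) Ky | proj₁ (proj₂ (proj₂ size)) has0
    ... | i , y≈eᵢ | j , 0≈eⱼ with i ≟ j
    ...   | yes P.refl = yes (trans y≈eᵢ (sym 0≈eⱼ))
    ...   | no i≢j = no (λ y≈0 → i≢j (proj₂ (proj₂ (proj₂ size)) i j (trans (sym y≈eᵢ) (trans y≈0 0≈eⱼ))))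

    -- In L: x is zero iff all its K-coordinates in the basis are.
    zero? : ∀ x → Dec (x ≈ 0#)
    zero? x with proj₂ (proj₂ degree) x
    ... | cs , Kcs , x≈ with all? (λ i → zero?-K (Kcs i))
    ...   | yes cs≈0 = yes (trans x≈ (sumR-zeros (λ i → trans (*-cong (cs≈0 i) refl) (zeroˡ _))))
    ...   | no ¬cs≈0 = no (λ x≈0 → ¬cs≈0 (proj₁ (proj₂ degree) cs Kcs (trans (sym x≈) x≈0)))

  module WithSubfield (sub : IsSubfield) where
    open IsSubfield sub

    KIndep-tail : ∀ {m N} (w : Fin (suc m) → Vec N) → KIndep w → KIndep (w ∘ suc)
    KIndep-tail w w-indep cs Kcs comb≈0 i = w-indep cs′ Kcs′ comb′≈0 (suc i)
      where
      cs′ : Fin _ → Carrier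
      cs′ zero = 0#
      cs′ (suc j) = cs j
      Kcs′ : ∀ j → K (cs′ j)
      Kcs′ zero = has0
      Kcs′ (suc j) = Kcs j
      comb′≈0 : ∀ x → lincomb cs′ w x ≈ 0#
      comb′≈0 x = trans (+-cong (zeroˡ _) (comb≈0 x)) (+-identityʳ 0#)

    KDim≤-mono : ∀ {a N} {S : Pred (Vec N) a} {d D} → d ≤′ D → KDim≤ S d → KDim≤ S D
    KDim≤-mono (≤′-reflexive P.refl) dim≤d = dim≤d
    KDim≤-mono {S = S} (≤′-step d≤D) dim≤d w Sw w-indep =
      KDim≤-mono {S = S} d≤D dim≤d (w ∘ suc) (Sw ∘ suc) (KIndep-tail w w-indep)

    line∩-restrict : ∀ {a N r d} (π : Fin r → Fin N) {U′ : Pred (Vec r) a} {U : Pred (Vec N) a}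
      → (∀ {v} → U v → U′ (v ∘ π)) → Evasive U′ 1 d
      → (b : Fin 1 → Vec N) (i₀ : Fin r) {β⁻¹ : Carrier} → b zero (π i₀) * β⁻¹ ≈ 1#
      → KDim≤ (LineMeet b U) d
    line∩-restrict π {U′} U⊆U′ (_ , evasive) b i₀ inv w w∈ w-indep =
      evasive restrict-b (unit-coordinate⇒LIndep restrict-b i₀ inv) (restrict ∘ w) restrict-w∈ restrict-w-indep
      where
      restrict : Vec _ → Vec _
      restrict v = v ∘ π
      restrict-b : Fin 1 → Vec _
      restrict-b = restrict ∘ b
      restrict-w∈ : ∀ l → LSpanFam restrict-b (restrict (w l)) × U′ (restrict (w l))
      restrict-w∈ l = (proj₁ (proj₁ (w∈ l)) , proj₂ (proj₁ (w∈ l)) ∘ π) , U⊆U′ (proj₂ (w∈ l))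
      -- a K-relation among the restrictions is a vector of ⟨b⟩ vanishing at π i₀
      restrict-w-indep : KIndep (restrict ∘ w)
      restrict-w-indep cs Kcs comb≈0 = w-indep cs Kcs
        (vanish-on-line (π i₀) (lincomb-on-line cs w coeff (b zero) (λ l → on-line {b = b} (proj₁ (w∈ l)))) (comb≈0 i₀) inv)
        where
        coeff : Fin _ → Carrier
        coeff l = proj₁ (proj₁ (w∈ l)) zero

    -- Every line meets U₁ ⊕ U₂ in K-dimension at most k₁ ⊔ k₂: restrict to the
    -- block containing an invertible coordinate of the line's generator.
    ⊕-line∩ : IsFieldRing → (∀ x → Dec (x ≈ 0#))
      → ∀ {a r₁ r₂ k₁ k₂} {U₁ : Pred (Vec r₁) a} {U₂ : Pred (Vec r₂) a}
      → Evasive U₁ 1 k₁ → Evasive U₂ 1 k₂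
      → (b : Fin 1 → Vec (r₁ ℕ.+ r₂)) → LIndep b → KDim≤ (LineMeet b (U₁ ⊕ U₂)) (k₁ ⊔ k₂)
    ⊕-line∩ isField zero? {r₁ = r₁} {r₂} {k₁} {k₂} {U₁} {U₂} e₁ e₂ b b-indep
      with LIndep⇒unit-coordinate isField zero? b b-indep
    ... | x₀ , β⁻¹ , inv with block-of r₁ x₀
    ...   | inj₁ (i₀ , P.refl) =
            KDim≤-mono {S = LineMeet b (U₁ ⊕ U₂)} (≤⇒≤′ (m≤m⊔n k₁ k₂))
              (line∩-restrict (_↑ˡ r₂) {U₁} {U₁ ⊕ U₂} proj₁ e₁ b i₀ inv)
    ...   | inj₂ (j₀ , P.refl) =
            KDim≤-mono {S = LineMeet b (U₁ ⊕ U₂)} (≤⇒≤′ (m≤n⊔m k₁ k₂))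
              (line∩-restrict (r₁ ↑ʳ_) {U₂} {U₁ ⊕ U₂} proj₂ e₂ b j₀ inv)

theorem2p11 : ∀ {c ℓ k a : Level} (R : CommutativeRing c ℓ)
    (K : Pred (CommutativeRing.Carrier R) k)
    → Lin.IsFieldRing R K
    → Lin.IsSubfield R K
    → (q n : ℕ) → Lin.HasSize R K q → Lin.HasDegree R K n
    → (r₁ r₂ k₁ k₂ : ℕ)
    → (U₁ : Pred (Lin.Vec R K r₁) a) → (U₂ : Pred (Lin.Vec R K r₂) a)
    → Lin.IsKSubspace R K U₁ → Lin.Evasive R K U₁ 1 k₁
    → Lin.IsKSubspace R K U₂ → Lin.Evasive R K U₂ 1 k₂
    → Lin.IsKSubspace R K (Lin._⊕_ R K U₁ U₂)
    × Lin.Evasive R K (Lin._⊕_ R K U₁ U₂) 1 (k₁ ⊔ k₂)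
theorem2p11 R K isField sub _ _ size degree _ _ _ _ U₁ U₂ s₁ e₁ s₂ e₂ =
  ⊕-isKSubspace s₁ s₂ ,
  ⊕-LDimSpan≥ s₁ s₂ (proj₁ e₁) ,
  WithSubfield.⊕-line∩ sub isField (Finite.zero? sub size degree) {U₁ = U₁} {U₂ = U₂} e₁ e₂
  where open DirectSum R K
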